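{- For every $(u'',\ell')\in B_{m-1,n-1}\times B_{m-1,n}$ and every $y=(y_1,y_2)\in\mathbb{Z}^2$, $$T^{\le n}\big(M(u'',\ell',(y_1,y_2))\big)=M(u'',\ell',(y_1,y_2-1)),\qquad T^{>n}\big(M(u'',\ell',(y_1,y_2))\big)=M(u'',\ell',(y_1-1,y_2)).$$
   Context: $m,n$ positive integers. $B_{p,q}$ is the set of words over $\{N,E\}$ with $p$ letters $E$ and $q$ letters $N$, read as lattice paths ($N=(0,1)$, $E=(1,0)$). For $w\in B_{p,q}$, $w^{\mathbb{Z}}$ is the concatenation over $i\in\mathbb{Z}$ of the paths from $(pi,qi)$ with steps $w$. Let $R=(Nu'')^{\mathbb{Z}}$, $G=(E\ell')^{\mathbb{Z}}$. $N_i$ is the unique north step of $G$ starting at ordinate $i$, $X_1(N_i)$ the abscissa of its start; $E_j$ is the unique east step of $R$ starting at abscissa $j$, $X_2(E_j)$ the ordinate of its start. $M(u'',\ell',y)=(c_1,\dots,c_{n+m-1})$ with $c_{i+1}=X_1(N_{y_2+i})-y_1-1$ ($0\le i\le n-1$) and $c_{n+1+j}=X_2(E_{y_1+j})-y_2-1$ ($0\le j\le m-2$), a configuration on $K_{m,n}$ (vertices $v_1,\dots,v_{n+m}$, single edge between $v_i,v_j$ iff $i\le n<j$, sink $v_{n+m}$). Toppling $v_i$, $i\le n$, decreases $c_i$ by $m$ and increases $c_{n+1},\dots,c_{n+m-1}$ by 1; toppling $v_i$, $n<i<n+m$, decreases $c_i$ by $n$ and increases $c_1,\dots,c_n$ by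 1. For a sorted configuration $c$ ($c_1\le\dots\le c_n$, $c_{n+1}\le\dots\le c_{n+m-1}$), $T^{\le n}(c)$ is obtained by toppling $v_n$ then re-sorting entries $1,\dots,n$ weakly increasingly, and $T^{>n}(c)$ by toppling $v_{n+m-1}$ then re-sorting entries $n+1,\dots,n+m-1$. -}

module Defs where

open import Data.Nat as ℕ using (ℕ)
open import Data.Integer using (ℤ; _+_; _-_; _*_; +_; 1ℤ)
open import Data.Integer.Properties using (≤-decTotalOrder)
open import Data.List using (List; []; _∷_; length; lookup; take; map)
open import Data.Fin using (Fin; toℕ)
open import Data.Product using (Σ; _×_; ∃)
open import Relation.Binary.PropositionalEquality using (_≡_)
import Data.List.Sort

-- Letters of lattice-path words: N = (0,1), E = (1,0).
data Letter : Set where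
  N E : Letter

countE : List Letter → ℕ
countE []       = 0
countE (E ∷ w) = ℕ.suc (countE w)
countE (N ∷ w) = countE w

countN : List Letter → ℕ
countN []       = 0
countN (N ∷ w) = ℕ.suc (countN w)
countN (E ∷ w) = countN w

InB : ℕ → ℕ → List Letter → Set
InB p q w = (countE w ≡ p) × (countN w ≡ q)

-- StepAt w d x y : the bi-infinite path w^ℤ (concatenation over i ∈ ℤ of
-- the paths with steps w starting at (p i, q i), p = #E, q = #N of w)
-- has a step with letter d starting at the point (x , y).
StepAt : List Letter → Letter → ℤ → ℤ → Set
StepAt w d x y =
  Σ ℤ λ i → Σ (Fin (length w)) λ r →
    (lookup w r ≡ d) ×
    (x ≡ (+ countE w) * i + + countE (take (toℕ r) w)) ×
    (y ≡ (+ countN w) * i + + countN (take (toℕ r) w))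

-- R = (N u'')^ℤ ,  G = (E ℓ')^ℤ.
-- X1(N_i) = x  :⇔  the north step of G starting at ordinate i starts at abscissa x.
X1≡ : (ℓ' : List Letter) → ℤ → ℤ → Set
X1≡ ℓ' i x = StepAt (E ∷ ℓ') N x i

-- X2(E_j) = y  :⇔  the east step of R starting at abscissa j starts at ordinate y.
X2≡ : (u'' : List Letter) → ℤ → ℤ → Set
X2≡ u'' j y = StepAt (N ∷ u'') E j y

-- A configuration on K_{m,n} (sink v_{n+m} omitted) is stored as a pair
-- (A , B) with A = (c_1,…,c_n) and B = (c_{n+1},…,c_{n+m-1}).
Config : Set
Config = List ℤ × List ℤ

-- IsM m n u'' ℓ' y₁ y₂ c  :⇔  c = M(u'', ℓ', (y₁ , y₂)), i.e.
--   c_{i+1}   = X1(N_{y₂+i}) - y₁ - 1   (0 ≤ i ≤ n-1)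
--   c_{n+1+j} = X2(E_{y₁+j}) - y₂ - 1   (0 ≤ j ≤ m-2)
IsM : ℕ → ℕ → List Letter → List Letter → ℤ → ℤ → Config → Set
IsM m n u'' ℓ' y₁ y₂ (A Data.Product., B) =
  (length A ≡ n) × (length B ≡ m ℕ.∸ 1) ×
  ((i : Fin (length A)) → X1≡ ℓ' (y₂ + + toℕ i) (lookup A i + y₁ + 1ℤ)) ×
  ((j : Fin (length B)) → X2≡ u'' (y₁ + + toℕ j) (lookup B j + y₂ + 1ℤ))

decLast : ℤ → List ℤ → List ℤ
decLast k []           = []
decLast k (x ∷ [])     = (x - k) ∷ []
decLast k (x ∷ y ∷ xs) = x ∷ decLast k (y ∷ xs)

sortℤ : List ℤ → List ℤ
sortℤ = Data.List.Sort.sort ≤-decTotalOrder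

-- T^{≤n}: topple v_n (c_n -= m, c_{n+1..n+m-1} += 1), then re-sort c_1..c_n.
T≤ : ℕ → Config → Config
T≤ m (A Data.Product., B) = sortℤ (decLast (+ m) A) Data.Product., map (_+ 1ℤ) B

-- T^{>n}: topple v_{n+m-1} (c_{n+m-1} -= n, c_1..c_n += 1), then re-sort c_{n+1..n+m-1}.
T> : ℕ → Config → Config
T> n (A Data.Product., B) = map (_+ 1ℤ) A Data.Product., sortℤ (decLast (+ n) B)

-- Both M-rows are read off a periodic staircase: the entries of (c₁,…,cₙ) are
-- the abscissae of the north steps of G at n consecutive ordinates, and those of
-- (c_{n+1},…,c_{n+m-1}) the ordinates of the east steps of R at m-1 consecutive
-- abscissae, both shifted by y. Along a staircase these coordinates are weakly
-- increasing, so every M-row is sorted. Toppling v_n lowers the last entry by m,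
-- which by the period (m,n) of G turns it into the entry of the ordinate just
-- below the window; moved to the front it yields the row for y₂ - 1, which is
-- already sorted, so re-sorting changes nothing. Adding 1 to the other row is the
-- same as lowering y₂ by 1. Exchanging the roles of G and R gives T^{>n}.

module Submission where

open import Defs
open import Data.Nat using (ℕ; _≤_; _∸_)
open import Data.Integer using (ℤ; _-_; 1ℤ)
open import Data.List using (List)
open import Data.Product using (_×_; ∃)

open import Function using (_∘_)
open import Data.Nat as ℕ using (zero; suc; z≤n; s≤s)
import Data.Nat.Properties as ℕ
open import Data.Integer as ℤ using (+_; _+_; _*_; 0ℤ)
import Data.Integer.Properties as ℤ
open import Data.Integer.DivMod using (_%ℕ_; _/ℕ_; a≡a%ℕn+[a/ℕn]*n; n%ℕd<d)
open import Data.Integer.Tactic.RingSolver using (solve-∀)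
open import Data.Fin using (Fin; toℕ; zero; suc)
open import Data.Fin.Properties using (toℕ<n)
open import Data.List using ([]; _∷_; take; length; lookup; map; applyUpTo; _∷ʳ_; initLast; _∷ʳ′_)
open import Data.List.Properties using (length-map; length-applyUpTo; take-all)
open import Data.List.Relation.Unary.Linked using (Linked; []; [-]; _∷_)
open import Data.List.Relation.Unary.Sorted.TotalOrder ℤ.≤-totalOrder using (Sorted)
open import Data.List.Relation.Unary.Sorted.TotalOrder.Properties using (↗↭↗⇒≋)
open import Data.List.Relation.Binary.Pointwise using (Pointwise-≡⇒≡)
open import Data.List.Relation.Binary.Permutation.Propositional using (_↭_; ↭-refl; ↭-trans; ↭-sym; ↭-reflexive; ↭⇒↭ₛ)
open import Data.List.Relation.Binary.Permutation.Propositional.Properties using (∷↭∷ʳ; ↭-length)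
open import Data.List.Sort ℤ.≤-decTotalOrder using (sort-↭; sort-↗)
open import Data.Product using (Σ; _,_; proj₁; proj₂)
open import Data.Product.Relation.Binary.Lex.Strict using (×-Lex; ×-total₂)
open import Data.Sum using (_⊎_; inj₁; inj₂)
open import Data.Unit using (⊤; tt)
open import Relation.Nullary using (contradiction)
open import Relation.Binary.Definitions using (Total)
open import Relation.Binary.PropositionalEquality using (_≡_; refl; sym; trans; cong; subst; subst₂)

private
  variable
    A B : Set
    w : List Letter
    d : Letter
    x y x' y' : ℤ

PrefixMonotone : (List Letter → ℕ) → Set
PrefixMonotone cnt = ∀ w {r r'} → r ℕ.≤ r' → cnt (take r w) ℕ.≤ cnt (take r' w)

countE-take-mono : PrefixMonotone countE
countE-take-mono w       {zero}          _       = z≤n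
countE-take-mono []      {suc r} {suc r'} _       = z≤n
countE-take-mono (N ∷ w) {suc r} {suc r'} (s≤s p) = countE-take-mono w p
countE-take-mono (E ∷ w) {suc r} {suc r'} (s≤s p) = s≤s (countE-take-mono w p)

countN-take-mono : PrefixMonotone countN
countN-take-mono w       {zero}          _       = z≤n
countN-take-mono []      {suc r} {suc r'} _       = z≤n
countN-take-mono (E ∷ w) {suc r} {suc r'} (s≤s p) = countN-take-mono w p
countN-take-mono (N ∷ w) {suc r} {suc r'} (s≤s p) = s≤s (countN-take-mono w p)

offset : (List Letter → ℕ) → List Letter → ℤ → ℕ → ℤ
offset cnt w i r = + cnt w * i + + cnt (take r w)

_≤ₗₑₓ_ : ℤ × ℕ → ℤ × ℕ → Set
_≤ₗₑₓ_ = ×-Lex _≡_ ℤ._<_ ℕ._≤_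

≤ₗₑₓ-total : Total _≤ₗₑₓ_
≤ₗₑₓ-total = ×-total₂ sym ℤ.<-cmp ℕ.≤-total

offset-mono : ∀ cnt → PrefixMonotone cnt → ∀ w {i i'} {r r' : Fin (length w)} →
              (i , toℕ r) ≤ₗₑₓ (i' , toℕ r') →
              offset cnt w i (toℕ r) ℤ.≤ offset cnt w i' (toℕ r')
offset-mono cnt mono w {i} {i'} {r} {r'} (inj₁ i<i') = begin
  + cnt w * i + + cnt (take (toℕ r) w) ≤⟨ ℤ.+-monoʳ-≤ (+ cnt w * i) (ℤ.+≤+ prefix≤whole) ⟩
  + cnt w * i + + cnt w                ≡⟨ *-suc (+ cnt w) i ⟩
  + cnt w * (1ℤ + i)                   ≤⟨ ℤ.*-monoˡ-≤-nonNeg (+ cnt w) (ℤ.i<j⇒suc[i]≤j i<i') ⟩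
  + cnt w * i'                         ≤⟨ ℤ.i≤i+j _ _ ⟩
  offset cnt w i' (toℕ r')             ∎
  where
  open ℤ.≤-Reasoning
  prefix≤whole : cnt (take (toℕ r) w) ℕ.≤ cnt w
  prefix≤whole = subst (cnt (take (toℕ r) w) ℕ.≤_) (cong cnt (take-all (length w) w ℕ.≤-refl))
                       (mono w (ℕ.<⇒≤ (toℕ<n r)))
  *-suc : ∀ c i → c * i + c ≡ c * (1ℤ + i)
  *-suc = solve-∀
offset-mono cnt mono w {i} (inj₂ (refl , r≤r')) = ℤ.+-monoʳ-≤ (+ cnt w * i) (ℤ.+≤+ (mono w r≤r'))

stepAt-comparable : StepAt w d x y → StepAt w d x' y' →
                    (x ℤ.≤ x' × y ℤ.≤ y') ⊎ (x' ℤ.≤ x × y' ℤ.≤ y)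
stepAt-comparable {w} (i , r , _ , refl , refl) (i' , r' , _ , refl , refl)
  with ≤ₗₑₓ-total (i , toℕ r) (i' , toℕ r')
... | inj₁ lex = inj₁ (offset-mono countE countE-take-mono w lex , offset-mono countN countN-take-mono w lex)
... | inj₂ lex = inj₂ (offset-mono countE countE-take-mono w lex , offset-mono countN countN-take-mono w lex)

stepAt-abscissa-mono : StepAt w d x y → StepAt w d x' y' → y ℤ.< y' → x ℤ.≤ x'
stepAt-abscissa-mono {w} s s' y<y' with stepAt-comparable {w} s s'
... | inj₁ (x≤x' , _) = x≤x'
... | inj₂ (_ , y'≤y) = contradiction y'≤y (ℤ.<⇒≱ y<y')

stepAt-ordinate-mono : StepAt w d x y → StepAt w d x' y' → x ℤ.< x' → y ℤ.≤ y'
stepAt-ordinate-mono {w} s s' x<x' with stepAt-comparable {w} s s'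
... | inj₁ (_ , y≤y') = y≤y'
... | inj₂ (x'≤x , _) = contradiction x'≤x (ℤ.<⇒≱ x<x')

stepAt-periodic : StepAt w d x y → StepAt w d (x - + countE w) (y - + countN w)
stepAt-periodic {w} (i , r , w[r]≡d , refl , refl) =
  i - 1ℤ , r , w[r]≡d , previous-copy (+ countE w) i _ , previous-copy (+ countN w) i _
  where
  previous-copy : ∀ p i t → p * i + t - p ≡ p * (i - 1ℤ) + t
  previous-copy = solve-∀

kth-N : ∀ w k → k ℕ.< countN w →
        Σ (Fin (length w)) λ r → lookup w r ≡ N × countN (take (toℕ r) w) ≡ k
kth-N (N ∷ w) zero    _         = zero , refl , refl
kth-N (N ∷ w) (suc k) (s≤s k<) with kth-N w k k<
... | r , w[r]≡N , count≡k = suc r , w[r]≡N , cong suc count≡k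
kth-N (E ∷ w) k       k<        with kth-N w k k<
... | r , w[r]≡N , count≡k = suc r , w[r]≡N , count≡k

kth-E : ∀ w k → k ℕ.< countE w →
        Σ (Fin (length w)) λ r → lookup w r ≡ E × countE (take (toℕ r) w) ≡ k
kth-E (E ∷ w) zero    _         = zero , refl , refl
kth-E (E ∷ w) (suc k) (s≤s k<) with kth-E w k k<
... | r , w[r]≡E , count≡k = suc r , w[r]≡E , cong suc count≡k
kth-E (N ∷ w) k       k<        with kth-E w k k<
... | r , w[r]≡E , count≡k = suc r , w[r]≡E , count≡k

a≡q*[a/q]+a%q : ∀ q .{{_ : ℕ.NonZero q}} a → a ≡ + q * (a /ℕ q) + + (a %ℕ q)
a≡q*[a/q]+a%q q a = trans (a≡a%ℕn+[a/ℕn]*n a q) (reorder (+ (a %ℕ q)) (a /ℕ q) (+ q))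
  where
  reorder : ∀ k i q → k + i * q ≡ q * i + k
  reorder = solve-∀

stepAt-N-exists : ∀ w .{{_ : ℕ.NonZero (countN w)}} y → ∃ λ x → StepAt w N x y
stepAt-N-exists w y with kth-N w (y %ℕ countN w) (n%ℕd<d y (countN w))
... | r , w[r]≡N , count≡k =
  offset countE w i (toℕ r) , i , r , w[r]≡N , refl ,
  trans (a≡q*[a/q]+a%q (countN w) y) (cong (λ k → + countN w * i + + k) (sym count≡k))
  where i = y /ℕ countN w

stepAt-E-exists : ∀ w .{{_ : ℕ.NonZero (countE w)}} x → ∃ λ y → StepAt w E x y
stepAt-E-exists w x with kth-E w (x %ℕ countE w) (n%ℕd<d x (countE w))
... | r , w[r]≡E , count≡k =
  offset countN w i (toℕ r) , i , r , w[r]≡E ,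
  trans (a≡q*[a/q]+a%q (countE w) x) (cong (λ k → + countE w * i + + k) (sym count≡k)) , refl
  where i = x /ℕ countE w

AllIndexed : (ℕ → A → Set) → List A → Set
AllIndexed P []       = ⊤
AllIndexed P (x ∷ xs) = P 0 x × AllIndexed (P ∘ suc) xs

allIndexed-tabulate : ∀ {P : ℕ → A → Set} xs →
                      ((i : Fin (length xs)) → P (toℕ i) (lookup xs i)) → AllIndexed P xs
allIndexed-tabulate []       f = tt
allIndexed-tabulate (x ∷ xs) f = f zero , allIndexed-tabulate xs (f ∘ suc)

allIndexed-lookup : ∀ {P : ℕ → A → Set} {xs} →
                    AllIndexed P xs → (i : Fin (length xs)) → P (toℕ i) (lookup xs i)
allIndexed-lookup {xs = x ∷ xs} (p , ps) zero    = p
allIndexed-lookup {xs = x ∷ xs} (p , ps) (suc i) = allIndexed-lookup ps i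

allIndexed-mono : ∀ {P Q : ℕ → A → Set} → (∀ t {v} → P t v → Q t v) →
                  ∀ {xs} → AllIndexed P xs → AllIndexed Q xs
allIndexed-mono P⇒Q {[]}     _        = tt
allIndexed-mono P⇒Q {x ∷ xs} (p , ps) = P⇒Q 0 p , allIndexed-mono (P⇒Q ∘ suc) ps

allIndexed-map : ∀ {P : ℕ → A → Set} {Q : ℕ → B → Set} {f : A → B} → (∀ t {v} → P t v → Q t (f v)) →
                 ∀ {xs} → AllIndexed P xs → AllIndexed Q (map f xs)
allIndexed-map P⇒Qf {[]}     _        = tt
allIndexed-map P⇒Qf {x ∷ xs} (p , ps) = P⇒Qf 0 p , allIndexed-map (P⇒Qf ∘ suc) ps

allIndexed-∷ʳ⁻ : ∀ {P : ℕ → A → Set} xs {z} →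
                 AllIndexed P (xs ∷ʳ z) → AllIndexed P xs × P (length xs) z
allIndexed-∷ʳ⁻ []       (p , _)  = tt , p
allIndexed-∷ʳ⁻ (x ∷ xs) (p , ps) with allIndexed-∷ʳ⁻ xs ps
... | ps' , pz = (p , ps') , pz

allIndexed-linked : ∀ {P : ℕ → A → Set} {R : A → A → Set} →
                    (∀ t {v v'} → P t v → P (suc t) v' → R v v') →
                    ∀ {xs} → AllIndexed P xs → Linked R xs
allIndexed-linked step {[]}         _            = []
allIndexed-linked step {x ∷ []}     _            = [-]
allIndexed-linked step {x ∷ y ∷ xs} (p , q , ps) = step 0 p q ∷ allIndexed-linked (step ∘ suc) (q , ps)

allIndexed-applyUpTo : ∀ {P : ℕ → A → Set} {f} → (∀ t → P t (f t)) →
                       ∀ k → AllIndexed P (applyUpTo f k)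
allIndexed-applyUpTo Pf zero    = tt
allIndexed-applyUpTo Pf (suc k) = Pf 0 , allIndexed-applyUpTo (Pf ∘ suc) k

decLast-∷ʳ : ∀ k xs z → decLast k (xs ∷ʳ z) ≡ xs ∷ʳ (z - k)
decLast-∷ʳ k []           z = refl
decLast-∷ʳ k (x ∷ [])     z = refl
decLast-∷ʳ k (x ∷ y ∷ xs) z = cong (x ∷_) (decLast-∷ʳ k (y ∷ xs) z)

length-decLast : ∀ k xs → length (decLast k xs) ≡ length xs
length-decLast k []           = refl
length-decLast k (x ∷ [])     = refl
length-decLast k (x ∷ y ∷ xs) = cong suc (length-decLast k (y ∷ xs))

length-sortℤ-decLast : ∀ k xs → length (sortℤ (decLast k xs)) ≡ length xs
length-sortℤ-decLast k xs = trans (↭-length (sort-↭ _)) (length-decLast k xs)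

↭-sorted⇒sortℤ≡ : ∀ {xs ys} → Sorted ys → xs ↭ ys → sortℤ xs ≡ ys
↭-sorted⇒sortℤ≡ ys↗ xs↭ys =
  Pointwise-≡⇒≡ (↗↭↗⇒≋ ℤ.≤-totalOrder (sort-↗ _) ys↗ (↭⇒↭ₛ (↭-trans (sort-↭ _) xs↭ys)))

+-cancelʳ-≤ : ∀ i j k → i + k ℤ.≤ j + k → i ℤ.≤ j
+-cancelʳ-≤ i j k i+k≤j+k =
  subst₂ ℤ._≤_ (+-inverse-cancel i k) (+-inverse-cancel j k) (ℤ.+-monoˡ-≤ (ℤ.- k) i+k≤j+k)
  where
  +-inverse-cancel : ∀ i k → i + k + ℤ.- k ≡ i
  +-inverse-cancel = solve-∀

-- S a b says that the step of the staircase at index a sits at coordinate b;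
-- the staircase has period (p , q). A row describing the window starting at a₀,
-- offset by b₀, has t-th entry (coordinate at a₀ + t) - b₀ - 1, as in M.
module Staircase (S : ℤ → ℤ → Set) (p q : ℕ)
  (periodic : ∀ {a b} → S a b → S (a - + p) (b - + q))
  (monotone : ∀ {a a' b b'} → a ℤ.< a' → S a b → S a' b' → b ℤ.≤ b') where

  Entry : ℤ → ℤ → ℕ → ℤ → Set
  Entry a₀ b₀ t v = S (a₀ + + t) (v + b₀ + 1ℤ)

  Describes : ℤ → ℤ → List ℤ → Set
  Describes a₀ b₀ = AllIndexed (Entry a₀ b₀)

  describes-sorted : ∀ a₀ b₀ {xs} → Describes a₀ b₀ xs → Sorted xs
  describes-sorted a₀ b₀ = allIndexed-linked λ t {v} {v'} e e' →
    +-cancelʳ-≤ v v' b₀ (+-cancelʳ-≤ (v + b₀) (v' + b₀) 1ℤ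
      (monotone (ℤ.+-monoʳ-< a₀ (ℤ.+<+ (ℕ.n<1+n t))) e e'))

  describes-shift : ∀ a₀ b₀ {xs} → Describes a₀ b₀ xs → Describes a₀ (b₀ - 1ℤ) (map (_+ 1ℤ) xs)
  describes-shift a₀ b₀ = allIndexed-map λ t {v} → subst (S (a₀ + + t)) (sym (shift v b₀))
    where
    shift : ∀ v b → v + 1ℤ + (b - 1ℤ) + 1ℤ ≡ v + b + 1ℤ
    shift = solve-∀

  describes-topple : ∀ a₀ b₀ xs → length xs ≡ p → Describes a₀ b₀ xs →
                     Describes (a₀ - 1ℤ) b₀ (sortℤ (decLast (+ q) xs))
  describes-topple a₀ b₀ xs len≡p d with initLast xs
  ... | [] = subst (Describes (a₀ - 1ℤ) b₀) (sym (↭-sorted⇒sortℤ≡ [] ↭-refl)) tt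
  ... | ys ∷ʳ′ z =
    subst (Describes (a₀ - 1ℤ) b₀) (sym (↭-sorted⇒sortℤ≡ (describes-sorted (a₀ - 1ℤ) b₀ d') toppled↭)) d'
    where
    p≡1+l : p ≡ suc (length ys)
    p≡1+l = trans (sym len≡p) (sym (↭-length (∷↭∷ʳ z ys)))
    split : AllIndexed (Entry a₀ b₀) ys × Entry a₀ b₀ (length ys) z
    split = allIndexed-∷ʳ⁻ ys d
    window-below : ∀ a t → a + t - (1ℤ + t) ≡ a - 1ℤ + 0ℤ
    window-below = solve-∀
    lowered : ∀ v b k → v + b + 1ℤ - k ≡ v - k + b + 1ℤ
    lowered = solve-∀
    reindex : ∀ a t → a + t ≡ a - 1ℤ + (1ℤ + t)
    reindex = solve-∀
    -- By periodicity the lowered last entry is the entry just below the window.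
    first : Entry (a₀ - 1ℤ) b₀ 0 (z - + q)
    first = subst₂ S (window-below a₀ (+ length ys)) (lowered z b₀ (+ q))
                     (subst (λ k → S (a₀ + + length ys - + k) _) p≡1+l (periodic (proj₂ split)))
    d' : Describes (a₀ - 1ℤ) b₀ ((z - + q) ∷ ys)
    d' = first , allIndexed-mono (λ t {v} → subst (λ a → S a _) (reindex a₀ (+ t))) (proj₁ split)
    toppled↭ : decLast (+ q) (ys ∷ʳ z) ↭ (z - + q) ∷ ys
    toppled↭ = ↭-trans (↭-reflexive (decLast-∷ʳ (+ q) ys z)) (↭-sym (∷↭∷ʳ (z - + q) ys))

  describes-exists : (∀ a → ∃ (S a)) → ∀ a₀ b₀ k → Σ (List ℤ) λ xs → length xs ≡ k × Describes a₀ b₀ xs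
  describes-exists total a₀ b₀ k =
    applyUpTo entry k , length-applyUpTo entry k , allIndexed-applyUpTo entry-ok k
    where
    entry : ℕ → ℤ
    entry t = proj₁ (total (a₀ + + t)) - b₀ - 1ℤ
    unshift : ∀ x b → x - b - 1ℤ + b + 1ℤ ≡ x
    unshift = solve-∀
    entry-ok : ∀ t → Entry a₀ b₀ t (entry t)
    entry-ok t = subst (S (a₀ + + t)) (sym (unshift _ b₀)) (proj₂ (total (a₀ + + t)))

suc[m∸1]≡m : ∀ {m} → 1 ≤ m → suc (m ∸ 1) ≡ m
suc[m∸1]≡m {m} 1≤m = trans (ℕ.+-comm 1 (m ∸ 1)) (ℕ.m∸n+n≡m 1≤m)

module Configurations (m n : ℕ) (1≤m : 1 ≤ m) (1≤n : 1 ≤ n) (u'' ℓ' : List Letter)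
  (u''∈B : InB (m ∸ 1) (n ∸ 1) u'') (ℓ'∈B : InB (m ∸ 1) n ℓ') where

  #E-G : countE (E ∷ ℓ') ≡ m
  #E-G = trans (cong suc (proj₁ ℓ'∈B)) (suc[m∸1]≡m 1≤m)

  #N-R : countN (N ∷ u'') ≡ n
  #N-R = trans (cong suc (proj₂ u''∈B)) (suc[m∸1]≡m 1≤n)

  module G = Staircase (X1≡ ℓ') n m
    (λ {a} {b} s → subst₂ (λ p q → X1≡ ℓ' (a - + q) (b - + p)) #E-G (proj₂ ℓ'∈B) (stepAt-periodic s))
    (λ a<a' s s' → stepAt-abscissa-mono s s' a<a')

  module R = Staircase (X2≡ u'') (m ∸ 1) n
    (λ {a} {b} s → subst₂ (λ p q → X2≡ u'' (a - + p) (b - + q)) (proj₁ u''∈B) #N-R (stepAt-periodic s))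
    (λ a<a' s s' → stepAt-ordinate-mono s s' a<a')

  isM-from-rows : ∀ y₁ y₂ A B → length A ≡ n → length B ≡ m ∸ 1 →
                  G.Describes y₂ y₁ A → R.Describes y₁ y₂ B → IsM m n u'' ℓ' y₁ y₂ (A , B)
  isM-from-rows _ _ _ _ lA lB dA dB = lA , lB , allIndexed-lookup dA , allIndexed-lookup dB

  isM-exists : ∀ y₁ y₂ → ∃ λ c → IsM m n u'' ℓ' y₁ y₂ c
  isM-exists y₁ y₂ =
    let (A , lA , dA) = G.describes-exists north y₂ y₁ n
        (B , lB , dB) = rowR (m ∸ 1) (proj₁ u''∈B)
    in (A , B) , isM-from-rows y₁ y₂ A B lA lB dA dB
    where
    north : ∀ a → ∃ (X1≡ ℓ' a)
    north = stepAt-N-exists (E ∷ ℓ') {{ℕ.>-nonZero (subst (0 ℕ.<_) (sym (proj₂ ℓ'∈B)) 1≤n)}}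
    -- When m = 1, R = N^ℤ has no east step and the second row is empty.
    rowR : ∀ k → countE u'' ≡ k → Σ (List ℤ) λ B → length B ≡ k × R.Describes y₁ y₂ B
    rowR zero    _      = [] , refl , tt
    rowR (suc k) #E≡1+k = R.describes-exists east y₁ y₂ (suc k)
      where
      east : ∀ a → ∃ (X2≡ u'' a)
      east = stepAt-E-exists (N ∷ u'') {{ℕ.>-nonZero (subst (0 ℕ.<_) (sym #E≡1+k) (s≤s z≤n))}}

  rows-from-isM : ∀ y₁ y₂ A B → IsM m n u'' ℓ' y₁ y₂ (A , B) →
                  G.Describes y₂ y₁ A × R.Describes y₁ y₂ B
  rows-from-isM _ _ A B (_ , _ , fA , fB) = allIndexed-tabulate A fA , allIndexed-tabulate B fB

  isM-T≤ : ∀ y₁ y₂ c → IsM m n u'' ℓ' y₁ y₂ c → IsM m n u'' ℓ' y₁ (y₂ - 1ℤ) (T≤ m c)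
  isM-T≤ y₁ y₂ (A , B) isM@(lA , lB , _) =
    let (dA , dB) = rows-from-isM y₁ y₂ A B isM in
    isM-from-rows y₁ (y₂ - 1ℤ) _ _
      (trans (length-sortℤ-decLast _ A) lA) (trans (length-map _ B) lB)
      (G.describes-topple y₂ y₁ A lA dA) (R.describes-shift y₁ y₂ dB)

  isM-T> : ∀ y₁ y₂ c → IsM m n u'' ℓ' y₁ y₂ c → IsM m n u'' ℓ' (y₁ - 1ℤ) y₂ (T> n c)
  isM-T> y₁ y₂ (A , B) isM@(lA , lB , _) =
    let (dA , dB) = rows-from-isM y₁ y₂ A B isM in
    isM-from-rows (y₁ - 1ℤ) y₂ _ _
      (trans (length-map _ A) lA) (trans (length-sortℤ-decLast _ B) lB)
      (G.describes-shift y₂ y₁ dA) (R.describes-topple y₁ y₂ B lB dB)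

lemma5p7 : (m n : ℕ) → 1 ≤ m → 1 ≤ n →
    (u'' ℓ' : List Letter) → InB (m ∸ 1) (n ∸ 1) u'' → InB (m ∸ 1) n ℓ' →
    (y₁ y₂ : ℤ) →
    (∃ λ c → IsM m n u'' ℓ' y₁ y₂ c) ×
    ((c : Config) → IsM m n u'' ℓ' y₁ y₂ c →
      IsM m n u'' ℓ' y₁ (y₂ - 1ℤ) (T≤ m c) × IsM m n u'' ℓ' (y₁ - 1ℤ) y₂ (T> n c))
lemma5p7 m n 1≤m 1≤n u'' ℓ' u''∈B ℓ'∈B y₁ y₂ =
  isM-exists y₁ y₂ , λ c isM → isM-T≤ y₁ y₂ c isM , isM-T> y₁ y₂ c isM
  where open Configurations m n 1≤m 1≤n u'' ℓ' u''∈B ℓ'∈B
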